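{- Let $c$ be a variety of colored cube and $c^*$ its mirror image. Let $S$ be a collection consisting of seven cubes of variety $c$, seven cubes of variety $c^*$, and one cube of any other variety. Then $S$ has a subset of eight cubes that forms a corner solution modeled on either $c$ or $c^*$.
   Context: Fix a palette of six colors. A colored cube is a unit cube each face painted one color, all six colors appearing. Varieties are colored cubes up to rigid rotation; $c^*$ denotes the mirror image (reflection) of $c$. A corner solution is a set of eight cubes arranged into a $2\times2\times2$ cube with each outer face monochromatic; it is modeled on variety $v$ if the resulting big cube has the coloring of $v$. -}

module Defs where

open import Data.Bool using (Bool; true; false; not)
open import Data.Fin using (Fin; zero; suc)
open import Data.Product using (Σ; ∃; _×_; _,_)
open import Data.Sum using (_⊎_)
open import Data.List using (List; []; _∷_)
open import Data.Vec.Functional using (Vector; _++_)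
open import Relation.Binary.PropositionalEquality using (_≡_)
open import Function.Definitions using (Injective)

Color : Set
Color = Fin 6

-- Faces of a (unit or big) cube, all centred at the origin with axes
-- x = 0, y = 1, z = 2: the face (i , true) is the one whose outward
-- normal is +e_i, the face (i , false) the one with normal -e_i.
Face : Set
Face = Fin 3 × Bool

Coloring : Set
Coloring = Face → Color

IsColoredCube : Coloring → Set
IsColoredCube f = ∀ (k : Color) → ∃ λ (x : Face) → f x ≡ k

-- Generating rotations (as permutations of faces):
-- rx = quarter turn about the x-axis :  +y → +z → -y → -z → +y
-- ry = quarter turn about the y-axis :  +z → +x → -z → -x → +z
rx : Face → Face
rx (zero , b) = (zero , b)
rx (suc zero , true) = (suc (suc zero) , true)
rx (suc (suc zero) , true) = (suc zero , false)
rx (suc zero , false) = (suc (suc zero) , false)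
rx (suc (suc zero) , false) = (suc zero , true)

ry : Face → Face
ry (suc zero , b) = (suc zero , b)
ry (suc (suc zero) , true) = (zero , true)
ry (zero , true) = (suc (suc zero) , false)
ry (suc (suc zero) , false) = (zero , false)
ry (zero , false) = (suc (suc zero) , true)

data Gen : Set where
  gx gy : Gen

gen : Gen → Face → Face
gen gx = rx
gen gy = ry

-- The rotation group of the cube (24 elements) is generated by rx and ry;
-- a rotation is represented by a word in the generators.
Rot : Set
Rot = List Gen

act : Rot → Face → Face
act [] f = f
act (g ∷ w) f = gen g (act w f)

SameVariety : Coloring → Coloring → Set
SameVariety c d = Σ Rot λ w → ∀ (x : Face) → d x ≡ c (act w x)

reflectX : Face → Face
reflectX (zero , b) = (zero , not b)
reflectX (suc i , b) = (suc i , b)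

mirror : Coloring → Coloring
mirror c x = c (reflectX x)

-- Cells of the 2×2×2 arrangement; coord p i = true means p sits on the
-- positive side along axis i.
Pos : Set
Pos = Bool × Bool × Bool

coord : Pos → Fin 3 → Bool
coord (a , b , c) zero = a
coord (a , b , c) (suc zero) = b
coord (a , b , c) (suc (suc zero)) = c

-- A corner solution made of eight of the cubes S : Fin n → Coloring,
-- modeled on (the variety of) v: choose eight distinct cubes (ι injective),
-- place them in the eight cells with orientations o; each outer face (i , b)
-- of the big cube is monochromatic of colour K (i , b), and the big cube's
-- coloring K is of the variety of v.
CornerSolutionIn : ∀ {n} → (Fin n → Coloring) → Coloring → Set
CornerSolutionIn {n} S v =
  Σ (Pos → Fin n) λ ι →
  Injective _≡_ _≡_ ι ×
  Σ (Pos → Rot) λ o →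
  Σ Coloring λ K →
    (∀ (p : Pos) (i : Fin 3) →
       S (ι p) (act (o p) (i , coord p i)) ≡ K (i , coord p i))
    × SameVariety v K

collection : (Fin 7 → Coloring) → (Fin 7 → Coloring) → Coloring → Fin 15 → Coloring
collection A B e = (A ++ B) ++ (λ (_ : Fin 1) → e)

module Submission where

-- Let e be the odd cube.  Since c and e both show all six colours, e = c ∘ ψ
-- for a permutation ψ of the faces.  The heart of the proof is that some
-- corner of e is a corner of a rotated copy of c or of c*:
--   * matching: ψ carries the three faces at some corner onto three faces on
--     distinct axes.  The map axis ∘ ψ hits every axis exactly twice, so no
--     three faces collide, and a finite check over all 3⁶ maps from faces to
--     axes shows that every map without such a collision splits a corner;
--   * frames: three faces on distinct axes are the images of the faces at any
--     given corner under one of the 48 symmetries of the cube (finite check).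
-- If that symmetry is a rotation r, put e at that corner and the seven copies
-- of c in the other cells, each turned to be colored like c ∘ act r; the big
-- cube is then colored like c ∘ act r.  If the symmetry involves the
-- reflection, the same works with c* and its seven copies.

open import Defs
open import Data.Bool using (Bool; true; false; T)
open import Data.Bool.Properties using () renaming (_≟_ to _≟ᵇ_)
open import Data.Empty using (⊥; ⊥-elim)
open import Data.Fin using (Fin; zero; suc; punchOut; splitAt; _↑ˡ_; _↑ʳ_)
open import Data.Fin.Properties
  using (punchOut-injective; injective⇒≤; splitAt-↑ˡ; splitAt-↑ʳ;
         ↑ˡ-injective; ↑ʳ-injective; *↔×; 2↔Bool)
  renaming (_≟_ to _≟ᶠ_; any? to anyFin?)
open import Data.Bool.ListAction using (all)
open import Data.List using (List; []; _∷_; _++_; map; allFin; cartesianProduct)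
open import Data.List.Membership.Propositional using (_∈_)
open import Data.List.Membership.Propositional.Properties using (∈-allFin; ∈-cartesianProduct⁺)
open import Data.List.Relation.Unary.All as All using ()
open import Data.List.Relation.Unary.All.Properties using (all⁺)
open import Data.List.Relation.Unary.Any using (Any; here; there; satisfied; any?)
open import Data.Nat as ℕ using ()
open import Data.Nat.Properties using (1+n≰n)
open import Data.Product using (Σ; ∃; ∃₂; _×_; _,_; proj₁; proj₂)
open import Data.Product.Function.NonDependent.Propositional using (_×-↔_)
open import Data.Sum using (_⊎_; inj₁; inj₂)
import Data.Vec.Functional as Vec
open import Data.Vec.Functional.Properties using (lookup-++ˡ; lookup-++ʳ)
open import Function using (_∘_)
open import Function.Bundles using (Injection; _↔_)
open import Function.Definitions using (Injective)
open import Function.Properties.Inverse using (↔-refl; ↔-sym; ↔-trans; ↔⇒↣)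
open import Relation.Binary.Definitions using (DecidableEquality)
open import Relation.Binary.PropositionalEquality
  using (_≡_; _≢_; refl; sym; trans; cong; cong₂; subst; module ≡-Reasoning)
open import Relation.Nullary using (¬_; Dec; yes; no)
open import Relation.Nullary.Decidable using (⌊_⌋; toWitness; map′; ¬?; _×-dec_; _⊎-dec_; _→-dec_)
open import Relation.Unary using (Decidable)

act-++ : ∀ u w x → act (u ++ w) x ≡ act u (act w x)
act-++ []      w x = refl
act-++ (g ∷ u) w x = cong (gen g) (act-++ u w x)

gen-order4 : ∀ g x → gen g (gen g (gen g (gen g x))) ≡ x
gen-order4 gx (zero , b) = refl
gen-order4 gx (suc zero , true) = refl
gen-order4 gx (suc zero , false) = refl
gen-order4 gx (suc (suc zero) , true) = refl
gen-order4 gx (suc (suc zero) , false) = refl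
gen-order4 gy (zero , true) = refl
gen-order4 gy (zero , false) = refl
gen-order4 gy (suc zero , b) = refl
gen-order4 gy (suc (suc zero) , true) = refl
gen-order4 gy (suc (suc zero) , false) = refl

inverse : Rot → Rot
inverse []      = []
inverse (g ∷ w) = inverse w ++ (g ∷ g ∷ g ∷ [])

act-inverse : ∀ w x → act w (act (inverse w) x) ≡ x
act-inverse []      x = refl
act-inverse (g ∷ w) x = begin
  gen g (act w (act (inverse w ++ g ∷ g ∷ g ∷ []) x))
    ≡⟨ cong (gen g ∘ act w) (act-++ (inverse w) _ x) ⟩
  gen g (act w (act (inverse w) (gen g (gen g (gen g x)))))
    ≡⟨ cong (gen g) (act-inverse w _) ⟩
  gen g (gen g (gen g (gen g x)))
    ≡⟨ gen-order4 g x ⟩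
  x ∎
  where open ≡-Reasoning

-- A complete list of the elements of a type turns a
-- decidable property into a boolean test over the list; evaluating the test
-- to true proves the property everywhere.  Only the final boolean is
-- computed, so large case checks stay cheap.
Enumeration : Set → Set
Enumeration A = Σ (List A) λ xs → ∀ x → x ∈ xs

enumerate-Bool : Enumeration Bool
enumerate-Bool = true ∷ false ∷ [] , λ { true → here refl ; false → there (here refl) }

enumerate-Fin : ∀ n → Enumeration (Fin n)
enumerate-Fin n = allFin n , ∈-allFin

enumerate-× : ∀ {A B} → Enumeration A → Enumeration B → Enumeration (A × B)
enumerate-× (xs , x∈xs) (ys , y∈ys) =
  cartesianProduct xs ys , λ (x , y) → ∈-cartesianProduct⁺ (x∈xs x) (y∈ys y)

enumerate-Face : Enumeration Face
enumerate-Face = enumerate-× (enumerate-Fin 3) enumerate-Bool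

enumerate-Pos : Enumeration Pos
enumerate-Pos = enumerate-× enumerate-Bool (enumerate-× enumerate-Bool enumerate-Bool)

checkAll : ∀ {A} {P : A → Set} → Enumeration A → Decidable P → Bool
checkAll (xs , _) P? = all (λ x → ⌊ P? x ⌋) xs

-- Opaque, so that uses of the lemma never unfold the check it rests on.
opaque
  checkAll-sound : ∀ {A} {P : A → Set} (E : Enumeration A) (P? : Decidable P) →
    T (checkAll E P?) → ∀ x → P x
  checkAll-sound (xs , x∈xs) P? ok x = toWitness (All.lookup (all⁺ _ xs ok) (x∈xs x))

_≟-face_ : DecidableEquality Face
(i , a) ≟-face (j , b) = map′ (λ (i≡j , a≡b) → cong₂ _,_ i≡j a≡b) (λ eq → cong proj₁ eq , cong proj₂ eq)
                              (i ≟ᶠ j ×-dec a ≟ᵇ b)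

-- Statements about a triple indexed by the three axes, spelled out
-- componentwise so that they can be checked on explicit triples.
All3 : (Fin 3 → Set) → Set
All3 P = P zero × P (suc zero) × P (suc (suc zero))

all3 : {P : Fin 3 → Set} → All3 P → ∀ i → P i
all3 (p , q , r) zero = p
all3 (p , q , r) (suc zero) = q
all3 (p , q , r) (suc (suc zero)) = r

Distinct3 : {A : Set} → (Fin 3 → A) → Set
Distinct3 v = v zero ≢ v (suc zero) × v zero ≢ v (suc (suc zero)) × v (suc zero) ≢ v (suc (suc zero))

distinct3? : ∀ {A : Set} → DecidableEquality A → (v : Fin 3 → A) → Dec (Distinct3 v)
distinct3? _≟_ v = ¬? (v zero ≟ v (suc zero)) ×-dec ¬? (v zero ≟ v (suc (suc zero)))
                   ×-dec ¬? (v (suc zero) ≟ v (suc (suc zero)))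

distinct3-resp : ∀ {A : Set} {v w : Fin 3 → A} → (∀ i → v i ≡ w i) → Distinct3 v → Distinct3 w
distinct3-resp {v = v} {w} v≗w (d₀₁ , d₀₂ , d₁₂) = transport d₀₁ , transport d₀₂ , transport d₁₂
  where
  transport : ∀ {i j} → v i ≢ v j → w i ≢ w j
  transport {i} {j} d eq = d (trans (v≗w i) (trans eq (sym (v≗w j))))

triple : {A : Set} → A → A → A → Fin 3 → A
triple a b c zero = a
triple a b c (suc zero) = b
triple a b c (suc (suc zero)) = c

-- The three faces of the unit cube meeting at the vertex pointing towards
-- cell s; they lie on the three axes, in order.
cornerFace : Pos → Fin 3 → Face
cornerFace s i = i , coord s i

axis : Face → Fin 3
axis = proj₁

-- The symmetries of the cube: a rotation, followed by the reflection when
-- the flag is set.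
reflectIf : Bool → Face → Face
reflectIf false x = x
reflectIf true  x = reflectX x

-- One word for each of the 24 rotations of the cube.
rotations : List Rot
rotations =
  [] ∷ (gx ∷ []) ∷ (gy ∷ []) ∷ (gx ∷ gx ∷ []) ∷ (gy ∷ gx ∷ []) ∷ (gx ∷ gy ∷ []) ∷
  (gy ∷ gy ∷ []) ∷ (gx ∷ gx ∷ gx ∷ []) ∷ (gy ∷ gx ∷ gx ∷ []) ∷ (gx ∷ gy ∷ gx ∷ []) ∷
  (gy ∷ gy ∷ gx ∷ []) ∷ (gx ∷ gx ∷ gy ∷ []) ∷ (gx ∷ gy ∷ gy ∷ []) ∷ (gy ∷ gy ∷ gy ∷ []) ∷
  (gy ∷ gx ∷ gx ∷ gx ∷ []) ∷ (gx ∷ gy ∷ gx ∷ gx ∷ []) ∷ (gy ∷ gy ∷ gx ∷ gx ∷ []) ∷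
  (gx ∷ gx ∷ gy ∷ gx ∷ []) ∷ (gy ∷ gy ∷ gy ∷ gx ∷ []) ∷ (gx ∷ gx ∷ gx ∷ gy ∷ []) ∷
  (gx ∷ gy ∷ gy ∷ gy ∷ []) ∷ (gx ∷ gy ∷ gx ∷ gx ∷ gx ∷ []) ∷
  (gx ∷ gx ∷ gx ∷ gy ∷ gx ∷ []) ∷ (gx ∷ gy ∷ gy ∷ gy ∷ gx ∷ []) ∷ []

symmetries : List (Bool × Rot)
symmetries = cartesianProduct (proj₁ enumerate-Bool) rotations

CarriedBy : Pos → (Fin 3 → Face) → Bool × Rot → Set
CarriedBy s t (b , r) = All3 λ i → t i ≡ reflectIf b (act r (cornerFace s i))

carriedBy? : ∀ s t → Decidable (CarriedBy s t)
carriedBy? s t (b , r) = eq? zero ×-dec eq? (suc zero) ×-dec eq? (suc (suc zero))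
  where
  eq? : ∀ i → Dec (t i ≡ reflectIf b (act r (cornerFace s i)))
  eq? i = t i ≟-face reflectIf b (act r (cornerFace s i))

FrameCarried : Pos × Face × Face × Face → Set
FrameCarried (s , t₀ , t₁ , t₂) =
  Distinct3 (axis ∘ triple t₀ t₁ t₂) → Any (CarriedBy s (triple t₀ t₁ t₂)) symmetries

frameCarried? : Decidable FrameCarried
frameCarried? (s , t₀ , t₁ , t₂) =
  distinct3? _≟ᶠ_ (axis ∘ triple t₀ t₁ t₂) →-dec any? (carriedBy? s (triple t₀ t₁ t₂)) symmetries

enumerate-frames : Enumeration (Pos × Face × Face × Face)
enumerate-frames = enumerate-× enumerate-Pos
  (enumerate-× enumerate-Face (enumerate-× enumerate-Face enumerate-Face))

frames-checked : T (checkAll enumerate-frames frameCarried?)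
frames-checked = _

frame : ∀ s (t : Fin 3 → Face) → Distinct3 (axis ∘ t) →
  ∃₂ λ b r → ∀ i → t i ≡ reflectIf b (act r (cornerFace s i))
frame s t distinct = carrier (satisfied (frames-carried distinct))
  where
  frames-carried : FrameCarried (s , t zero , t (suc zero) , t (suc (suc zero)))
  frames-carried = checkAll-sound enumerate-frames frameCarried? frames-checked
    (s , t zero , t (suc zero) , t (suc (suc zero)))
  carrier : ∃ (CarriedBy s (triple (t zero) (t (suc zero)) (t (suc (suc zero))))) →
    ∃₂ λ b r → ∀ i → t i ≡ reflectIf b (act r (cornerFace s i))
  carrier ((b , r) , eqs) = b , r , all3 eqs

SplitAt : (Face → Fin 3) → Pos → Set
SplitAt α s = Distinct3 (α ∘ cornerFace s)

CollideAt : (Face → Fin 3) → Face × Face × Face → Set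
CollideAt α (x , y , z) = Distinct3 (triple x y z) × α x ≡ α y × α x ≡ α z

pairsOf : ∀ {A : Set} → List A → List (A × A)
pairsOf []       = []
pairsOf (x ∷ xs) = map (x ,_) xs ++ pairsOf xs

triplesOf : ∀ {A : Set} → List A → List (A × A × A)
triplesOf []       = []
triplesOf (x ∷ xs) = map (x ,_) (pairsOf xs) ++ triplesOf xs

Dichotomy : (Face → Fin 3) → Set
Dichotomy α = Any (SplitAt α) (proj₁ enumerate-Pos) ⊎ Any (CollideAt α) (triplesOf (proj₁ enumerate-Face))

dichotomy? : ∀ α → Dec (Dichotomy α)
dichotomy? α = any? (λ s → distinct3? _≟ᶠ_ (α ∘ cornerFace s)) (proj₁ enumerate-Pos)
  ⊎-dec any? (λ (x , y , z) → distinct3? _≟-face_ (triple x y z) ×-dec α x ≟ᶠ α y ×-dec α x ≟ᶠ α z)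
             (triplesOf (proj₁ enumerate-Face))

Table : Set
Table = Fin 3 × Fin 3 × Fin 3 × Fin 3 × Fin 3 × Fin 3

fromTable : Table → Face → Fin 3
fromTable (a , b , c , d , e , f) (zero , true) = a
fromTable (a , b , c , d , e , f) (zero , false) = b
fromTable (a , b , c , d , e , f) (suc zero , true) = c
fromTable (a , b , c , d , e , f) (suc zero , false) = d
fromTable (a , b , c , d , e , f) (suc (suc zero) , true) = e
fromTable (a , b , c , d , e , f) (suc (suc zero) , false) = f

toTable : (Face → Fin 3) → Table
toTable α = α (zero , true) , α (zero , false) , α (suc zero , true) ,
            α (suc zero , false) , α (suc (suc zero) , true) , α (suc (suc zero) , false)

fromTable-toTable : ∀ α x → fromTable (toTable α) x ≡ α x
fromTable-toTable α (zero , true) = refl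
fromTable-toTable α (zero , false) = refl
fromTable-toTable α (suc zero , true) = refl
fromTable-toTable α (suc zero , false) = refl
fromTable-toTable α (suc (suc zero) , true) = refl
fromTable-toTable α (suc (suc zero) , false) = refl

enumerate-Table : Enumeration Table
enumerate-Table = enumerate-× F (enumerate-× F (enumerate-× F (enumerate-× F (enumerate-× F F))))
  where
  F : Enumeration (Fin 3)
  F = enumerate-Fin 3

tables-checked : T (checkAll enumerate-Table (dichotomy? ∘ fromTable))
tables-checked = _

splits-or-collides : ∀ α → ∃ (SplitAt α) ⊎ ∃ (CollideAt α)
splits-or-collides α = fromDichotomy
  (checkAll-sound enumerate-Table (dichotomy? ∘ fromTable) tables-checked (toTable α))
  where
  β : Face → Fin 3
  β = fromTable (toTable α)

  sameValue : ∀ {u v} → β u ≡ β v → α u ≡ α v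
  sameValue {u} {v} eq = trans (sym (fromTable-toTable α u)) (trans eq (fromTable-toTable α v))

  fromDichotomy : Dichotomy β → ∃ (SplitAt α) ⊎ ∃ (CollideAt α)
  fromDichotomy (inj₁ split) with satisfied split
  ... | s , distinct = inj₁ (s , distinct3-resp (fromTable-toTable α ∘ cornerFace s) distinct)
  fromDichotomy (inj₂ collide) with satisfied collide
  ... | (x , y , z) , distinct , xy , xz = inj₂ ((x , y , z) , distinct , sameValue xy , sameValue xz)

-- Each axis carries only two faces, so no three distinct faces share an axis.
sameAxis-at-most-two : ∀ x y z → Distinct3 (triple x y z) → axis x ≡ axis y → axis x ≡ axis z → ⊥
sameAxis-at-most-two (i , true)  (.i , true)  _           (x≢y , _)       refl refl = x≢y refl
sameAxis-at-most-two (i , false) (.i , false) _           (x≢y , _)       refl refl = x≢y refl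
sameAxis-at-most-two (i , true)  (.i , false) (.i , true)  (_ , x≢z , _)  refl refl = x≢z refl
sameAxis-at-most-two (i , false) (.i , true)  (.i , false) (_ , x≢z , _)  refl refl = x≢z refl
sameAxis-at-most-two (i , true)  (.i , false) (.i , false) (_ , _ , y≢z)  refl refl = y≢z refl
sameAxis-at-most-two (i , false) (.i , true)  (.i , true)  (_ , _ , y≢z)  refl refl = y≢z refl

permutation-splits-corner : (ψ : Face → Face) → Injective _≡_ _≡_ ψ → ∃ (SplitAt (axis ∘ ψ))
permutation-splits-corner ψ ψ-inj with splits-or-collides (axis ∘ ψ)
... | inj₁ split = split
... | inj₂ ((x , y , z) , (x≢y , x≢z , y≢z) , xy , xz) =
  ⊥-elim (sameAxis-at-most-two (ψ x) (ψ y) (ψ z)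
    (x≢y ∘ ψ-inj , x≢z ∘ ψ-inj , y≢z ∘ ψ-inj) xy xz)

injective⇒surjective : ∀ {n} (g : Fin n → Fin n) → Injective _≡_ _≡_ g → ∀ y → ∃ λ x → g x ≡ y
injective⇒surjective {ℕ.suc n} g g-inj y with anyFin? (λ x → g x ≟ᶠ y)
... | yes hit  = hit
... | no  miss = ⊥-elim (1+n≰n (injective⇒≤ squeeze-inj))
  where
  squeeze : Fin (ℕ.suc n) → Fin n
  squeeze x = punchOut {i = y} {j = g x} (λ eq → miss (x , sym eq))

  squeeze-inj : Injective _≡_ _≡_ squeeze
  squeeze-inj eq = g-inj (punchOut-injective {i = y} _ _ eq)

surjective⇒injective : ∀ {A : Set} {n} → A ↔ Fin n → (f : A → Fin n) →
  (∀ k → ∃ λ x → f x ≡ k) → Injective _≡_ _≡_ f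
surjective⇒injective {A} A↔Fin f f-surj {x} {y} fx≡fy = begin
  x             ≡⟨ sym (section-after-f x) ⟩
  section (f x) ≡⟨ cong section fx≡fy ⟩
  section (f y) ≡⟨ section-after-f y ⟩
  y ∎
  where
  open ≡-Reasoning
  open Injection (↔⇒↣ A↔Fin) using (to) renaming (injective to to-inj)

  section : Fin _ → A
  section k = proj₁ (f-surj k)

  section-inj : Injective _≡_ _≡_ section
  section-inj {k} {l} eq = trans (sym (proj₂ (f-surj k))) (trans (cong f eq) (proj₂ (f-surj l)))

  -- The section is injective between sets of the same size, hence onto.
  section-after-f : ∀ a → section (f a) ≡ a
  section-after-f a with injective⇒surjective (to ∘ section) (section-inj ∘ to-inj) (to a)
  ... | k , eq with to-inj eq
  ...   | refl = cong section (proj₂ (f-surj k))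

faceCount : Face ↔ Fin 6
faceCount = ↔-trans (↔-refl ×-↔ ↔-sym 2↔Bool) (↔-sym *↔×)

recolouring : ∀ {c e} → IsColoredCube c → IsColoredCube e →
  ∃ λ ψ → Injective _≡_ _≡_ ψ × (∀ x → e x ≡ c (ψ x))
recolouring {c} {e} c-onto e-onto = ψ , ψ-inj , λ x → sym (proj₂ (c-onto (e x)))
  where
  ψ : Face → Face
  ψ x = proj₁ (c-onto (e x))

  ψ-inj : Injective _≡_ _≡_ ψ
  ψ-inj {x} {y} eq = surjective⇒injective faceCount e e-onto
    (trans (sym (proj₂ (c-onto (e x)))) (trans (cong c eq) (proj₂ (c-onto (e y)))))

corner-of-c-or-mirror : ∀ {c e} → IsColoredCube c → IsColoredCube e →
  ∃ λ s → ∃₂ λ b r → ∀ i → e (cornerFace s i) ≡ c (reflectIf b (act r (cornerFace s i)))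
corner-of-c-or-mirror {c} c-onto e-onto with recolouring c-onto e-onto
... | ψ , ψ-inj , e≗cψ with permutation-splits-corner ψ ψ-inj
...   | s , split with frame s (ψ ∘ cornerFace s) split
...     | b , r , eqs = s , b , r , λ i → trans (e≗cψ (cornerFace s i)) (cong c (eqs i))

reorient : ∀ v {d} ((w , _) : SameVariety v d) r x → d (act (inverse w ++ r) x) ≡ v (act r x)
reorient v {d} (w , d≗vw) r x = begin
  d (act (inverse w ++ r) x)            ≡⟨ d≗vw _ ⟩
  v (act w (act (inverse w ++ r) x))    ≡⟨ cong (v ∘ act w) (act-++ (inverse w) r x) ⟩
  v (act w (act (inverse w) (act r x))) ≡⟨ cong v (act-inverse w (act r x)) ⟩
  v (act r x) ∎
  where open ≡-Reasoning

cellIndex : Pos ↔ Fin 8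
cellIndex = ↔-trans (bit ×-↔ (bit ×-↔ bit)) (↔-trans (↔-refl ×-↔ ↔-sym *↔×) (↔-sym *↔×))
  where
  bit : Bool ↔ Fin 2
  bit = ↔-sym 2↔Bool

-- Put S E in cell s and the cubes S (J k) in the seven other cells,
-- each turned to be colored like v ∘ act r: every outer face of the big cube
-- then shows the colour of v ∘ act r on that face.
cornerSolution : ∀ {n} (S : Fin n → Coloring) (v : Coloring) (J : Fin 7 → Fin n) (E : Fin n) →
  Injective _≡_ _≡_ J → (∀ k → J k ≢ E) → (∀ k → SameVariety v (S (J k))) →
  ∀ s r → (∀ i → S E (cornerFace s i) ≡ v (act r (cornerFace s i))) → CornerSolutionIn S v
cornerSolution S v J E J-inj J≢E J-variety s r corner =
  ι , (λ {p} {q} → ι-inj p q (cell s ≟ᶠ cell p) (cell s ≟ᶠ cell q)) ,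
  o , v ∘ act r , (λ p → fits p (cell s ≟ᶠ cell p)) , (r , λ _ → refl)
  where
  open Injection (↔⇒↣ cellIndex) renaming (to to cell; injective to cell-inj)

  -- Cell s holds S E; the other cells are numbered 0..6 by punching out s.
  ι′ : ∀ p → Dec (cell s ≡ cell p) → Fin _
  ι′ p (yes _) = E
  ι′ p (no s≢p) = J (punchOut s≢p)

  o′ : ∀ p → Dec (cell s ≡ cell p) → Rot
  o′ p (yes _) = []
  o′ p (no s≢p) = inverse (proj₁ (J-variety (punchOut s≢p))) ++ r

  ι : Pos → Fin _
  ι p = ι′ p (cell s ≟ᶠ cell p)

  o : Pos → Rot
  o p = o′ p (cell s ≟ᶠ cell p)

  ι-inj : ∀ p q d₁ d₂ → ι′ p d₁ ≡ ι′ q d₂ → p ≡ q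
  ι-inj p q (yes s≡p) (yes s≡q) _  = trans (sym (cell-inj {s} {p} s≡p)) (cell-inj s≡q)
  ι-inj p q (yes _)   (no _)    eq = ⊥-elim (J≢E _ (sym eq))
  ι-inj p q (no _)    (yes _)   eq = ⊥-elim (J≢E _ eq)
  ι-inj p q (no s≢p)  (no s≢q)  eq = cell-inj {p} {q} (punchOut-injective s≢p s≢q (J-inj eq))

  fits : ∀ p d i → S (ι′ p d) (act (o′ p d) (cornerFace p i)) ≡ v (act r (cornerFace p i))
  fits p (yes s≡p) i =
    subst (λ q → S E (cornerFace q i) ≡ v (act r (cornerFace q i))) (cell-inj {s} {p} s≡p) (corner i)
  fits p (no s≢p)  i = reorient v (J-variety (punchOut s≢p)) r (cornerFace p i)

copyOfC : Fin 7 → Fin 15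
copyOfC k = (k ↑ˡ 7) ↑ˡ 1

copyOfMirror : Fin 7 → Fin 15
copyOfMirror k = (7 ↑ʳ k) ↑ˡ 1

oddOne : Fin 15
oddOne = 14 ↑ʳ zero

copyOfC-inj : Injective _≡_ _≡_ copyOfC
copyOfC-inj = ↑ˡ-injective 7 _ _ ∘ ↑ˡ-injective 1 _ _

copyOfMirror-inj : Injective _≡_ _≡_ copyOfMirror
copyOfMirror-inj = ↑ʳ-injective 7 _ _ ∘ ↑ˡ-injective 1 _ _

↑ˡ≢↑ʳ : ∀ {m n} (i : Fin m) (j : Fin n) → i ↑ˡ n ≢ m ↑ʳ j
↑ˡ≢↑ʳ {m} {n} i j eq with trans (sym (splitAt-↑ˡ m i n)) (trans (cong (splitAt m) eq) (splitAt-↑ʳ m n j))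
... | ()

copyOfC≢oddOne : ∀ k → copyOfC k ≢ oddOne
copyOfC≢oddOne k = ↑ˡ≢↑ʳ (k ↑ˡ 7) zero

copyOfMirror≢oddOne : ∀ k → copyOfMirror k ≢ oddOne
copyOfMirror≢oddOne k = ↑ˡ≢↑ʳ (7 ↑ʳ k) zero

collection-copyOfC : ∀ A B e k → collection A B e (copyOfC k) ≡ A k
collection-copyOfC A B e k = trans (lookup-++ˡ (A Vec.++ B) (λ _ → e) (k ↑ˡ 7)) (lookup-++ˡ A B k)

collection-copyOfMirror : ∀ A B e k → collection A B e (copyOfMirror k) ≡ B k
collection-copyOfMirror A B e k = trans (lookup-++ˡ (A Vec.++ B) (λ _ → e) (7 ↑ʳ k)) (lookup-++ʳ A B k)

-- The theorem holds for any colored cube e.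
lemma5p5 : (c : Coloring) → IsColoredCube c →
    (A : Fin 7 → Coloring) → (∀ i → SameVariety c (A i)) →
    (B : Fin 7 → Coloring) → (∀ i → SameVariety (mirror c) (B i)) →
    (e : Coloring) → IsColoredCube e →
    ¬ SameVariety c e → ¬ SameVariety (mirror c) e →
    CornerSolutionIn (collection A B e) c ⊎ CornerSolutionIn (collection A B e) (mirror c)
lemma5p5 c c-colored A A-variety B B-variety e e-colored _ _ =
  place (corner-of-c-or-mirror c-colored e-colored)
  where
  S : Fin 15 → Coloring
  S = collection A B e

  copiesOfC : ∀ k → SameVariety c (S (copyOfC k))
  copiesOfC k = subst (SameVariety c) (sym (collection-copyOfC A B e k)) (A-variety k)

  copiesOfMirror : ∀ k → SameVariety (mirror c) (S (copyOfMirror k))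
  copiesOfMirror k = subst (SameVariety (mirror c)) (sym (collection-copyOfMirror A B e k)) (B-variety k)

  -- The odd cube goes to corner s; the symmetry found decides between c and c*.
  place : (∃ λ s → ∃₂ λ b r → ∀ i → e (cornerFace s i) ≡ c (reflectIf b (act r (cornerFace s i)))) →
    CornerSolutionIn S c ⊎ CornerSolutionIn S (mirror c)
  place (s , false , r , corner) = inj₁
    (cornerSolution S c copyOfC oddOne copyOfC-inj copyOfC≢oddOne copiesOfC s r corner)
  place (s , true , r , corner) = inj₂
    (cornerSolution S (mirror c) copyOfMirror oddOne copyOfMirror-inj copyOfMirror≢oddOne copiesOfMirror s r corner)
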